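{- Let $k\ge 3$ be an integer and let $G_k$ be the graph defined below. Then: (1) $\chi(G_k)=k+1$; (2) in every proper $(k+1)$-coloring of $G_k$, the vertices $u,v,u',v'$ receive the same color; (3) for every $x\in V(G_k)$ and every $\alpha\in\{1,\dots,k\}$, in every $(x,\alpha)$-connected greedy coloring of $G_k$ with $k+1$ colors, the vertices $u,v,u',v'$ receive colors at most $k$.
   Context: $G_k$ is constructed as follows: take three pairwise disjoint cliques $U,V,M$, each of size $k$, and let $w$ be a vertex of $M$. Add four new vertices $u,u',v,v'$; make $u$ and $u'$ adjacent to all of $U$, $v$ and $v'$ adjacent to all of $V$, $u$ and $v$ adjacent to all of $M\setminus\{w\}$, and $u'$ and $v'$ adjacent to $w$ (no other edges). A connected ordering of $V(G)$ is an ordering $(v_1,\dots,v_n)$ in which each $v_i$, $i\ge 2$, has a neighbour among $v_1,\dots,v_{i-1}$. Given a vertex $x$ and a positive integer $\alpha$, a coloring $f$ is an $(x,\alpha)$-connected greedy coloring of $G$ if there is a connected ordering starting with $x$ such that $f$ is obtained by coloring $x$ with $\alpha$ and then coloring each subsequent vertex in order with the smallest positive integer not used on its already-coloured neighbours. -}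

module Defs where

open import Data.Nat using (ℕ; _≤_; _<_; suc)
open import Data.Fin using (Fin; toℕ)
open import Data.Empty using (⊥)
open import Data.Unit using (⊤)
open import Data.Product using (_×_; ∃; Σ)
open import Data.List using (List; []; _∷_; _++_)
open import Data.List.Membership.Propositional using (_∈_)
open import Data.List.Relation.Unary.Unique.Propositional using (Unique)
open import Relation.Nullary using (¬_)
open import Relation.Binary.PropositionalEquality using (_≡_; _≢_)

data Vtx (k : ℕ) : Set where
  inU inV inM : Fin k → Vtx k
  u u' v v' : Vtx k

-- The distinguished vertex w of M is inM i with toℕ i ≡ 0.
IsW : ∀ {k} → Fin k → Set
IsW i = toℕ i ≡ 0

Adj : ∀ {k} → Vtx k → Vtx k → Set
Adj (inU i) (inU j) = i ≢ j
Adj (inV i) (inV j) = i ≢ j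
Adj (inM i) (inM j) = i ≢ j
Adj u  (inU _) = ⊤
Adj (inU _) u  = ⊤
Adj u' (inU _) = ⊤
Adj (inU _) u' = ⊤
Adj v  (inV _) = ⊤
Adj (inV _) v  = ⊤
Adj v' (inV _) = ⊤
Adj (inV _) v' = ⊤
Adj u  (inM i) = ¬ IsW i
Adj (inM i) u  = ¬ IsW i
Adj v  (inM i) = ¬ IsW i
Adj (inM i) v  = ¬ IsW i
Adj u' (inM i) = IsW i
Adj (inM i) u' = IsW i
Adj v' (inM i) = IsW i
Adj (inM i) v' = IsW i
Adj _ _ = ⊥

ProperColoring : ∀ k c → (Vtx k → Fin c) → Set
ProperColoring k c f = ∀ x y → Adj {k} x y → f x ≢ f y

Colorable : ℕ → ℕ → Set
Colorable k c = Σ (Vtx k → Fin c) (ProperColoring k c)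

ChromaticNumberIs : ℕ → ℕ → Set
ChromaticNumberIs k n = Colorable k n × (∀ c → Colorable k c → n ≤ c)

IsOrdering : ∀ k → List (Vtx k) → Set
IsOrdering k ord = Unique ord × (∀ y → y ∈ ord)

IsConnectedOrdering : ∀ k → List (Vtx k) → Set
IsConnectedOrdering k ord =
  IsOrdering k ord ×
  (∀ pre y post → ord ≡ pre ++ y ∷ post → pre ≢ [] →
     ∃ λ z → z ∈ pre × Adj z y)

GreedyStep : ∀ {k} → (Vtx k → ℕ) → List (Vtx k) → Vtx k → Set
GreedyStep {k} f pre y =
  1 ≤ f y ×
  (∀ z → z ∈ pre → Adj z y → f z ≢ f y) ×
  (∀ m → 1 ≤ m → m < f y → ∃ λ z → z ∈ pre × Adj z y × f z ≡ m)

ConnectedGreedy : ∀ k → Vtx k → ℕ → (Vtx k → ℕ) → Set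
ConnectedGreedy k x α f =
  ∃ λ (rest : List (Vtx k)) →
    IsConnectedOrdering k (x ∷ rest) ×
    f x ≡ α ×
    (∀ pre y post → x ∷ rest ≡ pre ++ y ∷ post → pre ≢ [] → GreedyStep f pre y)

module Submission where

-- (1) Colouring every clique by the index of its vertices and u,u',v,v' by a fresh
--     colour is proper; U ∪ {u} is a (k+1)-clique, so χ(G_k) = k+1.
-- (2) A proper (k+1)-colouring is injective on a k-clique, hence leaves exactly one
--     colour free; vertices avoiding all colours of the clique share that colour.
--     U gives f u = f u', V gives f v = f v', and M then gives f u = f v (u avoids
--     the colour of w because u' has the same colour and is adjacent to w).
-- (3) A connected greedy colouring with first colour α ≥ 1 is proper with positive
--     colours, so with at most k+1 colours part (2) applies to it.  If the common
--     colour of u,v,u',v' were the top colour k+1 (≥ 3 as k ≥ 2), look at a side U ∪ {u,u'} (or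
--     V ∪ {v,v'}) and its first vertex z in the ordering.  If z is not the start x,
--     then z is not in the clique (connectivity), not the hub u (it would need an
--     earlier neighbour of colour f w, which is adjacent to w), and not the pendant u'
--     (it would need earlier neighbours coloured 1 and 2, but its only neighbour
--     outside the side is w).  So x lies on both sides, which are disjoint.

open import Defs
open import Data.Bool using (Bool; true; false)
open import Data.Empty using (⊥; ⊥-elim)
open import Data.Fin using (Fin; zero; suc; toℕ; fromℕ; inject₁; fromℕ<)
open import Data.Fin.Properties
  using (_≟_; inject₁-injective; fromℕ≢inject₁; fromℕ<-injective; injective⇒≤; <⇒notInjective)
open import Data.List using (List; []; _∷_; _++_)
open import Data.List.Membership.Propositional using (_∈_)
open import Data.List.Membership.Propositional.Properties using (∈-∃++)
open import Data.List.Relation.Unary.All as All using (All)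
open import Data.List.Relation.Unary.Any using (here; there)
import Data.List.Relation.Unary.First as First
open First using (First)
open import Data.List.Relation.Unary.First.Properties using (toView)
open import Data.Nat using (ℕ; suc; _≤_; _<_; z≤n; s≤s; s≤s⁻¹)
import Data.Nat.Properties as ℕ
open import Data.Product using (_×_; _,_; proj₁; proj₂; ∃; ∃₂)
open import Data.Sum using (_⊎_; inj₁; inj₂)
open import Data.Unit using (tt)
open import Data.Vec.Functional using () renaming (_∷_ to _∷ᶠ_)
open import Function using (_∘_)
open import Function.Definitions using (Injective)
open import Relation.Nullary using (¬_; yes; no)
open import Relation.Binary.PropositionalEquality using (_≡_; _≢_; refl; sym; trans; cong; subst)
open Relation.Binary.PropositionalEquality.≡-Reasoning

adj-sym : ∀ {k} (x y : Vtx k) → Adj x y → Adj y x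
adj-sym (inU i) (inU j) i≢j = i≢j ∘ sym
adj-sym (inV i) (inV j) i≢j = i≢j ∘ sym
adj-sym (inM i) (inM j) i≢j = i≢j ∘ sym
adj-sym (inU i) u  a = a
adj-sym (inU i) u' a = a
adj-sym (inV i) v  a = a
adj-sym (inV i) v' a = a
adj-sym (inM i) u  a = a
adj-sym (inM i) u' a = a
adj-sym (inM i) v  a = a
adj-sym (inM i) v' a = a
adj-sym u  (inU j) a = a
adj-sym u  (inM j) a = a
adj-sym u' (inU j) a = a
adj-sym u' (inM j) a = a
adj-sym v  (inV j) a = a
adj-sym v  (inM j) a = a
adj-sym v' (inV j) a = a
adj-sym v' (inM j) a = a

adj⇒≢ : ∀ {k} {x y : Vtx k} → Adj x y → x ≢ y
adj⇒≢ {x = inU i} i≢i refl = i≢i refl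
adj⇒≢ {x = inV i} i≢i refl = i≢i refl
adj⇒≢ {x = inM i} i≢i refl = i≢i refl

IsClique : ∀ {k n} → (Fin n → Vtx k) → Set
IsClique q = ∀ i j → i ≢ j → Adj (q i) (q j)

U-clique : ∀ {k} → IsClique {k} inU
U-clique _ _ i≢j = i≢j

V-clique : ∀ {k} → IsClique {k} inV
V-clique _ _ i≢j = i≢j

M-clique : ∀ {k} → IsClique {k} inM
M-clique _ _ i≢j = i≢j

∷ᶠ-clique : ∀ {k n} {a : Vtx k} {q : Fin n → Vtx k} →
            IsClique q → (∀ i → Adj a (q i)) → IsClique (a ∷ᶠ q)
∷ᶠ-clique clique sees zero    zero    0≢0 = ⊥-elim (0≢0 refl)
∷ᶠ-clique clique sees zero    (suc j) _   = sees j
∷ᶠ-clique clique sees (suc i) zero    _   = adj-sym _ _ (sees i)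
∷ᶠ-clique clique sees (suc i) (suc j) i≢j = clique i j (i≢j ∘ cong suc)

clique-injective : ∀ {k c n} {f : Vtx k → Fin c} {q : Fin n → Vtx k} →
                   ProperColoring k c f → IsClique q → Injective _≡_ _≡_ (f ∘ q)
clique-injective proper clique {i} {j} same with i ≟ j
... | yes i≡j = i≡j
... | no  i≢j = ⊥-elim (proper _ _ (clique i j i≢j) same)

∷ᶠ-injective : ∀ {A : Set} {n} {a : A} {g : Fin n → A} →
               Injective _≡_ _≡_ g → (∀ i → a ≢ g i) → Injective _≡_ _≡_ (a ∷ᶠ g)
∷ᶠ-injective inj new {zero}  {zero}  _    = refl
∷ᶠ-injective inj new {zero}  {suc j} same = ⊥-elim (new j same)
∷ᶠ-injective inj new {suc i} {zero}  same = ⊥-elim (new i (sym same))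
∷ᶠ-injective inj new {suc i} {suc j} same = cong suc (inj same)

-- If k values out of k+1 are taken by an injective family, at most one value is left:
-- two values avoiding the family coincide (otherwise k+2 distinct values in Fin (k+1)).
free-value-unique : ∀ {k} (g : Fin k → Fin (suc k)) → Injective _≡_ _≡_ g →
                    ∀ a b → (∀ i → a ≢ g i) → (∀ i → b ≢ g i) → a ≡ b
free-value-unique g inj a b a-free b-free with a ≟ b
... | yes a≡b = a≡b
... | no  a≢b = ⊥-elim (<⇒notInjective ℕ.≤-refl
                          (∷ᶠ-injective (∷ᶠ-injective inj b-free) a-avoids))
  where
  a-avoids : ∀ i → a ≢ (b ∷ᶠ g) i
  a-avoids zero    = a≢b
  a-avoids (suc i) = a-free i

index-colouring : ∀ k → Vtx k → Fin (suc k)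
index-colouring k (inU i) = inject₁ i
index-colouring k (inV i) = inject₁ i
index-colouring k (inM i) = inject₁ i
index-colouring k _       = fromℕ k

index-colouring-proper : ∀ k → ProperColoring k (suc k) (index-colouring k)
index-colouring-proper k = proper
  where
  distinct-index : ∀ {i j : Fin k} → i ≢ j → inject₁ i ≢ inject₁ j
  distinct-index i≢j = i≢j ∘ inject₁-injective

  fresh : ∀ {i : Fin k} → inject₁ i ≢ fromℕ k
  fresh = fromℕ≢inject₁ ∘ sym

  proper : ProperColoring k (suc k) (index-colouring k)
  proper (inU i) (inU j) i≢j = distinct-index i≢j
  proper (inV i) (inV j) i≢j = distinct-index i≢j
  proper (inM i) (inM j) i≢j = distinct-index i≢j
  proper (inU i) u  _ = fresh
  proper (inU i) u' _ = fresh
  proper (inV i) v  _ = fresh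
  proper (inV i) v' _ = fresh
  proper (inM i) u  _ = fresh
  proper (inM i) u' _ = fresh
  proper (inM i) v  _ = fresh
  proper (inM i) v' _ = fresh
  proper u  (inU j) _ = fromℕ≢inject₁
  proper u  (inM j) _ = fromℕ≢inject₁
  proper u' (inU j) _ = fromℕ≢inject₁
  proper u' (inM j) _ = fromℕ≢inject₁
  proper v  (inV j) _ = fromℕ≢inject₁
  proper v  (inM j) _ = fromℕ≢inject₁
  proper v' (inV j) _ = fromℕ≢inject₁
  proper v' (inM j) _ = fromℕ≢inject₁

colours-≥ : ∀ {k c} → Colorable k c → suc k ≤ c
colours-≥ (f , proper) = injective⇒≤ (clique-injective proper U+u-clique)
  where
  U+u-clique : IsClique (u ∷ᶠ inU)
  U+u-clique = ∷ᶠ-clique U-clique (λ _ → tt)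

chromatic-number : ∀ k → ChromaticNumberIs k (suc k)
chromatic-number k = (index-colouring k , index-colouring-proper k) , λ _ → colours-≥

outer-same-colour : ∀ {k} (f : Vtx k → Fin (suc k)) → ProperColoring k (suc k) f →
                    f u ≡ f v × f u ≡ f u' × f u ≡ f v'
outer-same-colour f proper = u≡v , u≡u' , trans u≡v v≡v'
  where
  agree : ∀ {q} → IsClique q → ∀ a b → (∀ i → f a ≢ f (q i)) → (∀ i → f b ≢ f (q i)) → f a ≡ f b
  agree clique a b = free-value-unique _ (clique-injective proper clique) (f a) (f b)

  u≡u' : f u ≡ f u'
  u≡u' = agree U-clique u u' (λ i → proper u (inU i) tt) (λ i → proper u' (inU i) tt)

  v≡v' : f v ≡ f v'
  v≡v' = agree V-clique v v' (λ i → proper v (inV i) tt) (λ i → proper v' (inV i) tt)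

  avoids-M : ∀ h h' → f h ≡ f h' → (∀ i → ¬ IsW i → Adj h (inM i)) → (∀ i → IsW i → Adj h' (inM i)) →
             ∀ i → f h ≢ f (inM i)
  avoids-M h h' h≡h' sees sees' i with toℕ i ℕ.≟ 0
  ... | yes isW = proper h' (inM i) (sees' i isW) ∘ trans (sym h≡h')
  ... | no  notW = proper h (inM i) (sees i notW)

  u≡v : f u ≡ f v
  u≡v = agree M-clique u v (avoids-M u u' u≡u' (λ _ notW → notW) (λ _ isW → isW))
                           (avoids-M v v' v≡v' (λ _ notW → notW) (λ _ isW → isW))

Precedes : ∀ {A : Set} → List A → A → A → Set
Precedes L y z = ∃₂ λ pre post → L ≡ pre ++ z ∷ post × y ∈ pre

precedes-or-follows : ∀ {A : Set} (L : List A) {y z : A} → y ≢ z → y ∈ L → z ∈ L →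
                      Precedes L y z ⊎ Precedes L z y
precedes-or-follows (a ∷ L) y≢z (here refl) (here refl) = ⊥-elim (y≢z refl)
precedes-or-follows (a ∷ L) y≢z (here refl) (there z∈L) with ∈-∃++ z∈L
... | pre , post , L≡ = inj₁ (a ∷ pre , post , cong (a ∷_) L≡ , here refl)
precedes-or-follows (a ∷ L) y≢z (there y∈L) (here refl) with ∈-∃++ y∈L
... | pre , post , L≡ = inj₂ (a ∷ pre , post , cong (a ∷_) L≡ , here refl)
precedes-or-follows (a ∷ L) y≢z (there y∈L) (there z∈L) with precedes-or-follows L y≢z y∈L z∈L
... | inj₁ (pre , post , L≡ , y∈pre) = inj₁ (a ∷ pre , post , cong (a ∷_) L≡ , there y∈pre)
... | inj₂ (pre , post , L≡ , z∈pre) = inj₂ (a ∷ pre , post , cong (a ∷_) L≡ , there z∈pre)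

nonempty : ∀ {A : Set} {z : A} {L : List A} → z ∈ L → L ≢ []
nonempty (here _)  ()
nonempty (there _) ()

first-split : ∀ {A : Set} {P Q : A → Set} {L : List A} → First P Q L →
              ∃₂ λ pre post → ∃ λ z → L ≡ pre ++ z ∷ post × All P pre × Q z
first-split found with toView found
... | First._++_∷_ before qz post = _ , post , _ , refl , before , qz

module _ {k} {f : Vtx k → ℕ} {pre : List (Vtx k)} {y : Vtx k} (step : GreedyStep f pre y) where

  step-avoids : ∀ z → z ∈ pre → Adj z y → f z ≢ f y
  step-avoids = proj₁ (proj₂ step)

  step-minimal : ∀ m → 1 ≤ m → m < f y → ∃ λ z → z ∈ pre × Adj z y × f z ≡ m
  step-minimal = proj₂ (proj₂ step)

module ConnectedGreedyFacts {k} {x : Vtx k} {α} {f : Vtx k → ℕ} (greedy : ConnectedGreedy k x α f) where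

  ordering : List (Vtx k)
  ordering = x ∷ proj₁ greedy

  covers : ∀ y → y ∈ ordering
  covers = proj₂ (proj₁ (proj₁ (proj₂ greedy)))

  connected : ∀ pre y post → ordering ≡ pre ++ y ∷ post → pre ≢ [] → ∃ λ z → z ∈ pre × Adj z y
  connected = proj₂ (proj₁ (proj₂ greedy))

  starts : f x ≡ α
  starts = proj₁ (proj₂ (proj₂ greedy))

  step : ∀ pre y post → ordering ≡ pre ++ y ∷ post → pre ≢ [] → GreedyStep f pre y
  step = proj₂ (proj₂ (proj₂ greedy))

  positive : 1 ≤ α → ∀ y → 1 ≤ f y
  positive 1≤α y with covers y
  ... | here refl = subst (1 ≤_) (sym starts) 1≤α
  ... | there y∈rest with ∈-∃++ y∈rest
  ... | pre , post , rest≡ = proj₁ (step (x ∷ pre) y post (cong (x ∷_) rest≡) λ ())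

  -- The colouring is proper: of two adjacent vertices, the later one avoids the earlier.
  proper : ∀ y z → Adj y z → f y ≢ f z
  proper y z adj with precedes-or-follows ordering (adj⇒≢ adj) (covers y) (covers z)
  ... | inj₁ (pre , post , L≡ , y∈pre) =
    step-avoids (step pre z post L≡ (nonempty y∈pre)) y y∈pre adj
  ... | inj₂ (pre , post , L≡ , z∈pre) =
    step-avoids (step pre y post L≡ (nonempty z∈pre)) z z∈pre (adj-sym y z adj) ∘ sym

-- A colour in {1, …, c}, shifted down to an element of Fin c.
shift : ∀ {c y} → 1 ≤ y → y ≤ c → Fin c
shift (s≤s z≤n) y≤c = fromℕ< y≤c

shift-injective : ∀ {c y z} (p : 1 ≤ y) (q : y ≤ c) (p' : 1 ≤ z) (q' : z ≤ c) →
                  shift p q ≡ shift p' q' → y ≡ z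
shift-injective (s≤s z≤n) q (s≤s z≤n) q' same = cong suc (fromℕ<-injective _ _ q q' same)

-- In a connected greedy colouring of G_k with α ≥ 1 and colours at most k+1,
-- the vertices u, v, u', v' share a colour (part (2) applied to the shifted colouring).
greedy-outer-same-colour : ∀ {k x α} {f : Vtx k → ℕ} → ConnectedGreedy k x α f → 1 ≤ α →
                           (∀ y → f y ≤ suc k) → f u ≡ f v × f u ≡ f u' × f u ≡ f v'
greedy-outer-same-colour {k} {f = f} greedy 1≤α bounded =
  let u≡v , u≡u' , u≡v' = outer-same-colour g g-proper
  in unshift u≡v , unshift u≡u' , unshift u≡v'
  where
  open ConnectedGreedyFacts greedy

  g : Vtx k → Fin (suc k)
  g y = shift (positive 1≤α y) (bounded y)

  unshift : ∀ {y z} → g y ≡ g z → f y ≡ f z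
  unshift {y} {z} = shift-injective (positive 1≤α y) (bounded y) (positive 1≤α z) (bounded z)

  g-proper : ProperColoring k (suc k) g
  g-proper y z adj = proper y z adj ∘ unshift

w : ∀ {k} → Vtx (suc k)
w = inM zero

-- A side of G_k: a clique with a hub (also adjacent to M ∖ {w}) and a pendant (also
-- adjacent to w), given by its membership test.  U ∪ {u,u'} and V ∪ {v,v'} are sides.
record Side (k : ℕ) : Set where
  field
    member  : Vtx (suc k) → Bool
    hub     : Vtx (suc k)
    pendant : Vtx (suc k)
    pendant-member : member pendant ≡ true
    members : ∀ z → member z ≡ true →
              z ≡ hub ⊎ z ≡ pendant ⊎ (∀ t → Adj t z → member t ≡ true)
    hub-outside     : ∀ t → Adj t hub → member t ≡ false → Adj t w
    pendant-outside : ∀ t → Adj t pendant → member t ≡ false → t ≡ w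
    w-pendant       : Adj w pendant

module _ {k} (S : Side k) where
  open Side S

  Outside : Vtx (suc k) → Set
  Outside t = member t ≡ false

  Inside : Vtx (suc k) → Set
  Inside t = member t ≡ true

  outside-or-inside : ∀ t → Outside t ⊎ Inside t
  outside-or-inside t with member t
  ... | false = inj₁ refl
  ... | true  = inj₂ refl

module SideArgument {k} {x : Vtx (suc k)} {α} {f : Vtx (suc k) → ℕ}
       (greedy : ConnectedGreedy (suc k) x α f) (1≤α : 1 ≤ α)
       {c} (3≤c : 3 ≤ c) (bounded : ∀ y → f y ≤ c)
       (S : Side k) (hub-top : f (Side.hub S) ≡ c) (pendant-top : f (Side.pendant S) ≡ c) where
  open ConnectedGreedyFacts greedy
  open Side S

  -- w is adjacent to the pendant, so its colour is below the top.
  w-below : f w < c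
  w-below = ℕ.≤∧≢⇒< (bounded w) λ fw≡c → proper w pendant w-pendant (trans fw≡c (sym pendant-top))

  1<c : 1 < c
  1<c = ℕ.<-≤-trans (s≤s (s≤s z≤n)) 3≤c

  module Later (pre : List (Vtx (suc k))) (z : Vtx (suc k)) (post : List (Vtx (suc k)))
               (L≡ : ordering ≡ pre ++ z ∷ post) (pre≢[] : pre ≢ [])
               (outside : All (Outside S) pre) where

    minimal : ∀ m → 1 ≤ m → m < f z → ∃ λ t → t ∈ pre × Adj t z × f t ≡ m
    minimal = step-minimal (step pre z post L≡ pre≢[])

    -- the hub would need an earlier neighbour coloured like w, which is adjacent to w
    not-hub : z ≢ hub
    not-hub refl with t , t∈pre , adj , ft≡fw ← minimal (f w) (positive 1≤α w) (subst (f w <_) (sym hub-top) w-below)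
      = proper t w (hub-outside t adj (All.lookup outside t∈pre)) ft≡fw

    is-w : ∀ t → t ∈ pre → Adj t pendant → t ≡ w
    is-w t t∈pre adj = pendant-outside t adj (All.lookup outside t∈pre)

    -- the pendant would need earlier neighbours coloured 1 and 2, but both would be w
    not-pendant : z ≢ pendant
    not-pendant refl
      with t₁ , t₁∈pre , adj₁ , ft₁≡1 ← minimal 1 (s≤s z≤n) (subst (1 <_) (sym pendant-top) 1<c)
         | t₂ , t₂∈pre , adj₂ , ft₂≡2 ← minimal 2 (s≤s z≤n) (subst (2 <_) (sym pendant-top) 3≤c)
      with () ← begin
        1    ≡⟨ sym ft₁≡1 ⟩
        f t₁ ≡⟨ cong f (is-w t₁ t₁∈pre adj₁) ⟩
        f w  ≡⟨ cong f (is-w t₂ t₂∈pre adj₂) ⟨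
        f t₂ ≡⟨ ft₂≡2 ⟩
        2    ∎

    -- connectivity gives z an earlier neighbour, necessarily outside the side
    not-closed : ¬ (∀ t → Adj t z → Inside S t)
    not-closed closed
      with t , t∈pre , adj ← connected pre z post L≡ pre≢[]
      with () ← trans (sym (closed t adj)) (All.lookup outside t∈pre)

  -- The first vertex of the ordering inside the side (it exists: the pendant) must be x.
  starts-inside : Inside S x
  starts-inside with First.first (outside-or-inside S) ordering
  ... | inj₂ all-outside with () ← trans (sym pendant-member) (All.lookup all-outside (covers pendant))
  ... | inj₁ found with first-split found
  ... | [] , post , z , refl , _ , z-in = z-in
  ... | p ∷ pre , post , z , L≡ , outside , z-in with members z z-in
  ...   | inj₁ z≡hub            = ⊥-elim (Later.not-hub (p ∷ pre) z post L≡ (λ ()) outside z≡hub)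
  ...   | inj₂ (inj₁ z≡pendant) = ⊥-elim (Later.not-pendant (p ∷ pre) z post L≡ (λ ()) outside z≡pendant)
  ...   | inj₂ (inj₂ closed)    = ⊥-elim (Later.not-closed (p ∷ pre) z post L≡ (λ ()) outside closed)

in-U-side : ∀ {k} → Vtx k → Bool
in-U-side (inU _) = true
in-U-side u       = true
in-U-side u'      = true
in-U-side _       = false

U-side : ∀ {k} → Side k
U-side = record
  { member = in-U-side ; hub = u ; pendant = u' ; pendant-member = refl
  ; members = members ; hub-outside = hub-outside ; pendant-outside = pendant-outside
  ; w-pendant = refl }
  where
  U-closed : ∀ {k} i (t : Vtx k) → Adj t (inU i) → in-U-side t ≡ true
  U-closed i (inU _) _ = refl
  U-closed i u       _ = refl
  U-closed i u'      _ = refl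

  members : ∀ {k} (z : Vtx k) → in-U-side z ≡ true →
            z ≡ u ⊎ z ≡ u' ⊎ (∀ t → Adj t z → in-U-side t ≡ true)
  members (inU i) _ = inj₂ (inj₂ (U-closed i))
  members u       _ = inj₁ refl
  members u'      _ = inj₂ (inj₁ refl)

  hub-outside : ∀ {k} (t : Vtx (suc k)) → Adj t u → in-U-side t ≡ false → Adj t w
  hub-outside (inM i) i≠w _ = i≠w ∘ cong toℕ

  pendant-outside : ∀ {k} (t : Vtx (suc k)) → Adj t u' → in-U-side t ≡ false → t ≡ w
  pendant-outside (inM zero) _ _ = refl

in-V-side : ∀ {k} → Vtx k → Bool
in-V-side (inV _) = true
in-V-side v       = true
in-V-side v'      = true
in-V-side _       = false

V-side : ∀ {k} → Side k
V-side = record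
  { member = in-V-side ; hub = v ; pendant = v' ; pendant-member = refl
  ; members = members ; hub-outside = hub-outside ; pendant-outside = pendant-outside
  ; w-pendant = refl }
  where
  V-closed : ∀ {k} i (t : Vtx k) → Adj t (inV i) → in-V-side t ≡ true
  V-closed i (inV _) _ = refl
  V-closed i v       _ = refl
  V-closed i v'      _ = refl

  members : ∀ {k} (z : Vtx k) → in-V-side z ≡ true →
            z ≡ v ⊎ z ≡ v' ⊎ (∀ t → Adj t z → in-V-side t ≡ true)
  members (inV i) _ = inj₂ (inj₂ (V-closed i))
  members v       _ = inj₁ refl
  members v'      _ = inj₂ (inj₁ refl)

  hub-outside : ∀ {k} (t : Vtx (suc k)) → Adj t v → in-V-side t ≡ false → Adj t w
  hub-outside (inM i) i≠w _ = i≠w ∘ cong toℕ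

  pendant-outside : ∀ {k} (t : Vtx (suc k)) → Adj t v' → in-V-side t ≡ false → t ≡ w
  pendant-outside (inM zero) _ _ = refl

sides-disjoint : ∀ {k} (y : Vtx k) → in-U-side y ≡ true → in-V-side y ≡ true → ⊥
sides-disjoint (inU _) _ ()
sides-disjoint u       _ ()
sides-disjoint u'      _ ()

greedy-outer-below-top : ∀ {k x α} {f : Vtx (suc (suc k)) → ℕ} → 1 ≤ α →
                         ConnectedGreedy (suc (suc k)) x α f → (∀ y → f y ≤ suc (suc (suc k))) →
                         f u ≤ suc (suc k) × f v ≤ suc (suc k) × f u' ≤ suc (suc k) × f v' ≤ suc (suc k)
greedy-outer-below-top {k} {x} {f = f} 1≤α greedy bounded
  with u≡v , u≡u' , u≡v' ← greedy-outer-same-colour greedy 1≤α bounded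
  = u-below , subst (_≤ _) u≡v u-below , subst (_≤ _) u≡u' u-below , subst (_≤ _) u≡v' u-below
  where
  open SideArgument greedy 1≤α (s≤s (s≤s (s≤s z≤n))) bounded using (starts-inside)

  -- if u had the top colour, so would v, u', v', and x would lie on both sides
  u-not-top : f u ≢ suc (suc (suc k))
  u-not-top top = sides-disjoint x
    (starts-inside U-side top (trans (sym u≡u') top))
    (starts-inside V-side (trans (sym u≡v) top) (trans (sym u≡v') top))

  u-below : f u ≤ suc (suc k)
  u-below = s≤s⁻¹ (ℕ.≤∧≢⇒< (bounded u) u-not-top)

-- The theorem; part (3) does not need the bound α ≤ k.
lemma5 : (k : ℕ) → 3 ≤ k →
    ChromaticNumberIs k (suc k) ×
    (∀ (f : Vtx k → Fin (suc k)) → ProperColoring k (suc k) f →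
       f u ≡ f v × f u ≡ f u' × f u ≡ f v') ×
    (∀ (x : Vtx k) (α : ℕ) → 1 ≤ α → α ≤ k →
       ∀ (f : Vtx k → ℕ) → ConnectedGreedy k x α f →
       (∀ y → f y ≤ suc k) →
       f u ≤ k × f v ≤ k × f u' ≤ k × f v' ≤ k)
lemma5 1 (s≤s ())
lemma5 (suc (suc k)) _ =
  chromatic-number (suc (suc k)) ,
  outer-same-colour ,
  λ x α 1≤α _ f → greedy-outer-below-top 1≤α
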